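{- Let $l\ge 2$ and $m\ge 1$ be integers, and let $G=G(L^{(2)},x,y,l,m)$. Then $\tau(G)=\dfrac{l+3m}{1+2m}$.
   Context: All graphs are finite and simple. For $S\subseteq V(G)$, $G\setminus S$ is the subgraph induced on $V(G)\setminus S$ and $\omega(\cdot)$ is the number of components. The toughness $\tau(G)$ is the minimum of $|S|/\omega(G\setminus S)$ over all $S\subseteq V(G)$ with $\omega(G\setminus S)>1$ ($\tau(K_n)=\infty$). $L^{(1)}$ is the graph obtained from the $8$-cycle $w_1w_2\cdots w_8w_1$ by adding the edges $w_2w_4,w_4w_6,w_6w_8,w_2w_8$. $L^{(2)}$ is obtained from $L^{(1)}$ by deleting the edges $w_1w_2$, $w_2w_8$ and identifying $w_2$ with $w_8$; its distinguished vertices are $x=w_1$, $y=w_5$. For positive integers $l,m$, $G(L^{(2)},x,y,l,m)$ is defined as follows: take $m$ disjoint copies $L_1,\dots,L_m$ of $L^{(2)}$, with $x_i,y_i$ the vertices of $L_i$ corresponding to $x,y$; let $F_m$ be obtained from $L_1\cup\dots\cup L_m$ by adding all possible edges between pairs of vertices in $\{x_1,\dots,x_m,y_1,\dots,y_m\}$; let $T=K_l$; then $G(L^{(2)},x,y,l,m)=T\vee F_m$ (the join: disjoint union of $T$ and $F_m$ plus all edges between $V(T)$ and $V(F_m)$). -}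

module Defs where

open import Data.Nat using (ℕ; zero; suc; _+_; _*_; _≤_; _≡ᵇ_)
open import Data.Bool using (Bool; true; false; _∧_; _∨_; not; if_then_else_)
open import Data.Fin using (Fin; toℕ; splitAt; remQuot)
open import Data.Fin.Subset using (Subset; _∈_; _∉_; ∣_∣)
open import Data.List using (List; []; _∷_)
open import Data.Bool.ListAction using (any)
open import Data.Product using (Σ; _×_; _,_; ∃; ∃-syntax)
open import Data.Sum using (_⊎_; inj₁; inj₂)
open import Relation.Binary.PropositionalEquality using (_≡_)
open import Function.Bundles using (_⇔_)

-- (Symmetry/irreflexivity are not bundled; the concrete graph below is
-- symmetric and loopless by construction.)
Graph : ℕ → Set
Graph n = Fin n → Fin n → Bool

data Reach {n : ℕ} (G : Graph n) (S : Subset n) (u : Fin n) : Fin n → Set where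
  here : u ∉ S → Reach G S u u
  step : ∀ {v w} → Reach G S u v → G v w ≡ true → w ∉ S → Reach G S u w

-- ω(G \ S) = k : the vertices outside S are labelled by Fin k so that
-- equal labels ⇔ same component, and every label is used
-- (i.e. the components are in bijection with Fin k).
HasComponents : {n : ℕ} → Graph n → Subset n → ℕ → Set
HasComponents {n} G S k =
  Σ ((v : Fin n) → v ∉ S → Fin k) λ c →
    (∀ u v (hu : u ∉ S) (hv : v ∉ S) → (c u hu ≡ c v hv) ⇔ Reach G S u v)
    × (∀ (i : Fin k) → ∃[ v ] Σ (v ∉ S) λ hv → c v hv ≡ i)

-- τ(G) = a / b  (b > 0), as a minimum of |S| / ω(G \ S) over all S with
-- ω(G \ S) > 1 (fractions compared by cross-multiplication):
-- every such S has a/b ≤ |S|/ω, and some such S attains a/b.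
IsToughness : {n : ℕ} → Graph n → ℕ → ℕ → Set
IsToughness {n} G a b =
  (1 ≤ b)
  × (∀ (S : Subset n) (k : ℕ) → HasComponents G S k → 2 ≤ k → a * k ≤ b * ∣ S ∣)
  × (∃[ S ] ∃[ k ] (HasComponents G S k × 2 ≤ k × a * k ≡ b * ∣ S ∣))

EdgeList : Set
EdgeList = List (ℕ × ℕ)

hasEdge : EdgeList → ℕ → ℕ → Bool
hasEdge es a b = any (λ { (i , j) → ((i ≡ᵇ a) ∧ (j ≡ᵇ b)) ∨ ((i ≡ᵇ b) ∧ (j ≡ᵇ a)) }) es

-- L^(1): vertex label i ∈ {0..7} stands for w_{i+1}.
-- 8-cycle w1…w8w1 plus w2w4, w4w6, w6w8, w2w8.
L1edges : EdgeList
L1edges = (0 , 1) ∷ (1 , 2) ∷ (2 , 3) ∷ (3 , 4) ∷ (4 , 5) ∷ (5 , 6) ∷ (6 , 7) ∷ (7 , 0)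
        ∷ (1 , 3) ∷ (3 , 5) ∷ (5 , 7) ∷ (1 , 7) ∷ []

-- L^(1) minus the edges w1w2 (= (0,1)) and w2w8 (= (1,7)).
L1minus : EdgeList
L1minus = (1 , 2) ∷ (2 , 3) ∷ (3 , 4) ∷ (4 , 5) ∷ (5 , 6) ∷ (6 , 7) ∷ (7 , 0)
        ∷ (1 , 3) ∷ (3 , 5) ∷ (5 , 7) ∷ []

-- identification w8 ↦ w2 (label 7 ↦ 1); the result has vertices w1…w7,
-- labels 0…6, i.e. Fin 7.
ident : ℕ → ℕ
ident 7 = 1
ident i = i

identEdges : EdgeList → EdgeList
identEdges [] = []
identEdges ((i , j) ∷ es) = (ident i , ident j) ∷ identEdges es

L2adj : Fin 7 → Fin 7 → Bool
L2adj a b = not (toℕ a ≡ᵇ toℕ b) ∧ hasEdge (identEdges L1minus) (toℕ a) (toℕ b)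

-- distinguished vertices x = w1 (label 0) and y = w5 (label 4)
isXY : Fin 7 → Bool
isXY a = (toℕ a ≡ᵇ 0) ∨ (toℕ a ≡ᵇ 4)

-- F_m on Fin m × Fin 7 (copy index, vertex of L^(2)).
Fadj : {m : ℕ} → Fin m × Fin 7 → Fin m × Fin 7 → Bool
Fadj (i , a) (j , b) =
  ((toℕ i ≡ᵇ toℕ j) ∧ L2adj a b)
  ∨ (isXY a ∧ isXY b ∧ not ((toℕ i ≡ᵇ toℕ j) ∧ (toℕ a ≡ᵇ toℕ b)))

-- vertex set of G = Fin (l + m * 7): first l vertices are T = K_l,
-- the rest encode F_m via remQuot.
Gadj : (l m : ℕ) → Fin (l + m * 7) → Fin (l + m * 7) → Bool
Gadj l m u v with splitAt l u | splitAt l v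
... | inj₁ s | inj₁ t = not (toℕ s ≡ᵇ toℕ t)
... | inj₁ _ | inj₂ _ = true
... | inj₂ _ | inj₁ _ = true
... | inj₂ p | inj₂ q = Fadj (remQuot {m} 7 p) (remQuot {m} 7 q)

GL2 : (l m : ℕ) → Graph (l + m * 7)
GL2 = Gadj

-- A separator S of G = K_l ∨ F_m with at least two components contains all of T, since a
-- surviving vertex of T is adjacent to everything else. The components of G ∖ S are then the one
-- through the surviving x's and y's (which form a clique), plus, in each copy of L^(2), the local
-- components avoiding x and y. An exhaustive check over the 2⁷ traces of S on one copy shows that
-- a trace of size s leaves at most two such components and at most 2s/3 of them. So
-- ω(G ∖ S) ≤ 1 + C with C ≤ 2m and 3C ≤ 2(|S| − l), which gives (l + 3m) ω ≤ (1 + 2m) |S| when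
-- l ≥ 2. Equality holds for S = V(T) ∪ {w₂, w₄, w₆ in every copy}, leaving x's and y's together
-- and w₃, w₇ isolated in each copy: 1 + 2m components.

module Submission where

open import Defs
open import Data.Bool using (Bool; true; false; _∧_; _∨_; not; T; if_then_else_)
open import Data.Bool.Properties using (T-≡; T-∧; T-∨; ∨-zeroʳ) renaming (_≟_ to _≟ᵇ_)
open import Data.Empty using (⊥-elim)
open import Data.Fin using (Fin; zero; suc; toℕ; fromℕ<; _↑ˡ_; _↑ʳ_; combine; remQuot; splitAt; punchIn; punchOut)
open import Data.Fin.Properties
  using (_≟_; any?; all?; ¬∀⟶∃¬; ¬Fin0; suc-injective; toℕ-injective; injective⇒≤; punchOut-injective;
         punchIn-punchOut; punchIn-injective; punchInᵢ≢i; splitAt-↑ˡ; splitAt-↑ʳ; splitAt⁻¹-↑ˡ; splitAt⁻¹-↑ʳ;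
         remQuot-combine; combine-remQuot; combine-injective)
open import Data.Fin.Subset using (Subset; _∈_; _∉_; ∣_∣; inside; outside)
open import Data.Fin.Subset.Properties using (_∈?_; anySubset?)
open import Data.List using (_∷_; findᵇ) renaming (allFin to allFinᴸ)
open import Data.Maybe using (fromMaybe)
open import Data.Nat using (ℕ; zero; suc; _+_; _*_; _≤_; _≤?_; _≡ᵇ_; z≤n; s≤s)
open import Data.Nat.Properties
  using (+-assoc; +-mono-≤; +-monoʳ-≤; *-monoʳ-≤; *-monoˡ-≤; *-cancelˡ-≤; m≤m+n; m≤n+m; ≤-trans; <⇒≱;
         m≤n⇒∃[o]m+o≡n; m+[n∸m]≡n; ≡ᵇ⇒≡; ≡⇒≡ᵇ; *-zeroʳ; *-distribˡ-+; module ≤-Reasoning)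
open import Data.Nat.Tactic.RingSolver using (solve-∀)
open import Data.Product using (Σ; ∃; _×_; _,_; proj₁; proj₂; uncurry)
open import Data.Sum using (_⊎_; inj₁; inj₂; [_,_]′)
open import Data.Vec using (lookup; tabulate; _∷_; [])
open import Data.Vec.Properties using (lookup∘tabulate; tabulate∘lookup; tabulate-cong; []=⇒lookup; lookup⇒[]=)
open import Function using (_∘_)
open import Function.Definitions using (Injective)
open import Function.Bundles using (Equivalence; mk⇔)
open import Relation.Nullary using (Dec; yes; no; ¬?; _×-dec_; _⊎-dec_; _→-dec_; contradiction)
open import Relation.Nullary.Decidable using (isYes; map′; from-yes; decidable-stable; T?; toWitness; fromWitness)
open import Relation.Unary using (Pred; Decidable)
open import Relation.Binary.PropositionalEquality
  using (_≡_; _≢_; refl; sym; trans; cong; cong₂; subst; subst₂; module ≡-Reasoning)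

count : ∀ {n} → (Fin n → Bool) → ℕ
count {zero}  P = 0
count {suc n} P = (if P zero then 1 else 0) + count (P ∘ suc)

count-cong : ∀ {n} {P Q : Fin n → Bool} → (∀ i → P i ≡ Q i) → count P ≡ count Q
count-cong {zero}  P≗Q = refl
count-cong {suc n} P≗Q = cong₂ _+_ (cong (λ b → if b then 1 else 0) (P≗Q zero)) (count-cong (P≗Q ∘ suc))

count-head : ∀ {n} (P : Fin (suc n) → Bool) → T (P zero) → count P ≡ suc (count (P ∘ suc))
count-head P P₀ with P zero | P₀
... | true | _ = refl

count-true : ∀ {n} {P : Fin n → Bool} → (∀ i → T (P i)) → count P ≡ n
count-true {zero}      _ = refl
count-true {suc n} {P} P⊤ = trans (count-head P (P⊤ zero)) (cong suc (count-true (P⊤ ∘ suc)))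

∣p∣≡count : ∀ {n} (p : Subset n) → ∣ p ∣ ≡ count (lookup p)
∣p∣≡count []            = refl
∣p∣≡count (inside  ∷ p) = cong suc (∣p∣≡count p)
∣p∣≡count (outside ∷ p) = ∣p∣≡count p

count-++ : ∀ a {b} (P : Fin (a + b) → Bool) → count P ≡ count (P ∘ (_↑ˡ b)) + count (P ∘ (a ↑ʳ_))
count-++ zero    P = refl
count-++ (suc a) P = trans (cong (head +_) (count-++ a (P ∘ suc))) (sym (+-assoc head _ _))
  where head = if P zero then 1 else 0

injective⇒≤count : ∀ {k n} (P : Fin n → Bool) {f : Fin k → Fin n} →
                   Injective _≡_ _≡_ f → (∀ i → T (P (f i))) → k ≤ count P
injective⇒≤count {zero}          P     _     _  = z≤n
injective⇒≤count {suc k} {zero}  P {f} _     _  = ⊥-elim (¬Fin0 (f zero))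
injective⇒≤count {suc k} {suc n} P {f} f-inj Pf with any? (λ i → f i ≟ zero)
... | yes (i₀ , fi₀≡0) = begin
  suc k                  ≤⟨ s≤s (injective⇒≤count (P ∘ suc) g-inj
                              (λ j → subst (λ i → T (P i)) (sym (punchIn-punchOut (f≢0 j))) (Pf _))) ⟩
  suc (count (P ∘ suc))  ≡⟨ count-head P (subst (λ i → T (P i)) fi₀≡0 (Pf i₀)) ⟨
  count P                ∎
  where
  open ≤-Reasoning
  f≢0 : ∀ j → zero ≢ f (punchIn i₀ j)
  f≢0 j 0≡f = punchInᵢ≢i i₀ j (f-inj (trans (sym 0≡f) (sym fi₀≡0)))
  g-inj : Injective _≡_ _≡_ (λ j → punchOut (f≢0 j))
  g-inj {i} {j} gi≡gj = punchIn-injective i₀ i j (f-inj (punchOut-injective (f≢0 i) (f≢0 j) gi≡gj))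
... | no ∄ = begin
  suc k            ≤⟨ injective⇒≤count (P ∘ suc) g-inj
                        (λ i → subst (λ i → T (P i)) (sym (punchIn-punchOut (f≢0 i))) (Pf i)) ⟩
  count (P ∘ suc)  ≤⟨ m≤n+m _ _ ⟩
  count P          ∎
  where
  open ≤-Reasoning
  f≢0 : ∀ i → zero ≢ f i
  f≢0 i 0≡fi = ∄ (i , sym 0≡fi)
  g-inj : Injective _≡_ _≡_ (λ i → punchOut (f≢0 i))
  g-inj gi≡gj = f-inj (punchOut-injective (f≢0 _) (f≢0 _) gi≡gj)

sum : ∀ {m} → (Fin m → ℕ) → ℕ
sum {zero}  f = 0
sum {suc m} f = f zero + sum (f ∘ suc)

sum-mono-≤ : ∀ {m} {f g : Fin m → ℕ} → (∀ j → f j ≤ g j) → sum f ≤ sum g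
sum-mono-≤ {zero}  f≤g = z≤n
sum-mono-≤ {suc m} f≤g = +-mono-≤ (f≤g zero) (sum-mono-≤ (f≤g ∘ suc))

sum-const : ∀ {m c} {f : Fin m → ℕ} → (∀ j → f j ≡ c) → sum f ≡ m * c
sum-const {zero}  f≡c = refl
sum-const {suc m} f≡c = cong₂ _+_ (f≡c zero) (sum-const (f≡c ∘ suc))

*-distribˡ-sum : ∀ {m} c (f : Fin m → ℕ) → c * sum f ≡ sum (λ j → c * f j)
*-distribˡ-sum {zero}  c f = *-zeroʳ c
*-distribˡ-sum {suc m} c f = trans (*-distribˡ-+ c (f zero) _) (cong (c * f zero +_) (*-distribˡ-sum c (f ∘ suc)))

count-combine : ∀ m {n} {P : Fin (m * n) → Bool} (Q : Fin m → Fin n → Bool) →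
                (∀ j r → P (combine j r) ≡ Q j r) → count P ≡ sum (λ j → count (Q j))
count-combine zero    Q P≗Q = refl
count-combine (suc m) {n} {P} Q P≗Q =
  trans (count-++ n P) (cong₂ _+_ (count-cong (P≗Q zero)) (count-combine m (Q ∘ suc) (P≗Q ∘ suc)))

module _ {n : ℕ} {G : Graph n} {S : Subset n} where

  Reach-target∉ : ∀ {u v} → Reach G S u v → v ∉ S
  Reach-target∉ (here v∉)     = v∉
  Reach-target∉ (step _ _ v∉) = v∉

  Reach-source∉ : ∀ {u v} → Reach G S u v → u ∉ S
  Reach-source∉ (here u∉)       = u∉
  Reach-source∉ (step u⇝v _ _) = Reach-source∉ u⇝v

  Reach-trans : ∀ {u v w} → Reach G S u v → Reach G S v w → Reach G S u w
  Reach-trans u⇝v (here _)          = u⇝v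
  Reach-trans u⇝v (step v⇝w e w∉) = step (Reach-trans u⇝v v⇝w) e w∉

  Reach-invariant : ∀ {A : Set} (f : Fin n → A) →
                    (∀ {u v} → u ∉ S → v ∉ S → G u v ≡ true → f u ≡ f v) →
                    ∀ {u v} → Reach G S u v → f u ≡ f v
  Reach-invariant f f-edge (here _)          = refl
  Reach-invariant f f-edge (step u⇝v e w∉) = trans (Reach-invariant f f-edge u⇝v) (f-edge (Reach-target∉ u⇝v) w∉ e)

Reach-map : ∀ {n n′} {G : Graph n} {H : Graph n′} {S : Subset n} {S′ : Subset n′} (f : Fin n → Fin n′) →
            (∀ {u v} → G u v ≡ true → H (f u) (f v) ≡ true) → (∀ {v} → v ∉ S → f v ∉ S′) →
            ∀ {u v} → Reach G S u v → Reach H S′ (f u) (f v)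
Reach-map f f-edge f-∉ (here u∉)         = here (f-∉ u∉)
Reach-map f f-edge f-∉ (step u⇝v e w∉) = step (Reach-map f f-edge f-∉ u⇝v) (f-edge e) (f-∉ w∉)

reachableWithin : ∀ {n} → ℕ → Graph n → Subset n → Fin n → Fin n → Bool
reachableWithin zero    G S u v = isYes (u ≟ v ×-dec ¬? (u ∈? S))
reachableWithin (suc k) G S u v = reachableWithin zero G S u v
  ∨ isYes (any? λ w → (G w v ≟ᵇ true) ×-dec ¬? (v ∈? S) ×-dec T? (reachableWithin k G S u w))

reachableWithin-sound : ∀ {n} k {G : Graph n} {S u v} → T (reachableWithin k G S u v) → Reach G S u v
reachableWithin-sound zero {G} {S} {u} {v} found with toWitness {a? = u ≟ v ×-dec ¬? (u ∈? S)} found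
... | refl , u∉ = here u∉
reachableWithin-sound (suc k) {G} {S} {u} {v} found with Equivalence.to T-∨ found
... | inj₁ found₀ = reachableWithin-sound zero found₀
... | inj₂ found₁
  with toWitness {a? = any? λ w → (G w v ≟ᵇ true) ×-dec ¬? (v ∈? S) ×-dec T? (reachableWithin k G S u w)} found₁
...   | w , e , v∉ , u⇝w = step (reachableWithin-sound k u⇝w) e v∉

module _ {n k : ℕ} {G : Graph n} {S : Subset n} (components : HasComponents G S k) where

  private
    c = proj₁ components
    c≡⇔Reach = proj₁ (proj₂ components)
    c-onto = proj₂ (proj₂ components)

    rep : Fin k → Fin n
    rep i = proj₁ (c-onto i)

    rep∉ : ∀ i → rep i ∉ S
    rep∉ i = proj₁ (proj₂ (c-onto i))

    c-rep : ∀ i → c (rep i) (rep∉ i) ≡ i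
    c-rep i = proj₂ (proj₂ (c-onto i))

    Reach⇒c≡ : ∀ {u v} (u∉ : u ∉ S) (v∉ : v ∉ S) → Reach G S u v → c u u∉ ≡ c v v∉
    Reach⇒c≡ u∉ v∉ = Equivalence.from (c≡⇔Reach _ _ u∉ v∉)

  components≤count : ∀ {p} (label : Fin n → Fin p) (P : Fin p → Bool) →
                     (∀ {u v} → u ∉ S → v ∉ S → label u ≡ label v → Reach G S u v) →
                     (∀ {v} → v ∉ S → T (P (label v))) → k ≤ count P
  components≤count label P label≡⇒Reach label-P = injective⇒≤count P label∘rep-injective (label-P ∘ rep∉)
    where
    label∘rep-injective : Injective _≡_ _≡_ (label ∘ rep)
    label∘rep-injective {i} {j} eq =
      trans (sym (c-rep i)) (trans (Reach⇒c≡ (rep∉ i) (rep∉ j) (label≡⇒Reach (rep∉ i) (rep∉ j) eq)) (c-rep j))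

  reaches-all⇒components≤1 : ∀ {u} → u ∉ S → (∀ {v} → v ∉ S → Reach G S u v) → k ≤ 1
  reaches-all⇒components≤1 {u} u∉ u⇝ = injective⇒≤ {f = λ _ → zero} λ {i} {j} _ →
    trans (sym (trans (Reach⇒c≡ u∉ (rep∉ i) (u⇝ (rep∉ i))) (c-rep i)))
          (trans (Reach⇒c≡ u∉ (rep∉ j) (u⇝ (rep∉ j))) (c-rep j))

allSubset? : ∀ {n p} {P : Pred (Subset n) p} → Decidable P → Dec (∀ q → P q)
allSubset? P? = map′ (λ ∄¬P q → decidable-stable (P? q) (λ ¬Pq → ∄¬P (q , ¬Pq)))
                     (λ ∀P (q , ¬Pq) → ¬Pq (∀P q))
                     (¬? (anySubset? (¬? ∘ P?)))

-- Inside F_m each copy of L^(2) also carries the edge x y.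
copy : Graph 7
copy a c = L2adj a c ∨ (isXY a ∧ isXY c ∧ not (toℕ a ≡ᵇ toℕ c))

x₀ y₀ : Fin 7
x₀ = zero
y₀ = suc (suc (suc (suc zero)))

-- cut = {w₂, w₄, w₆}; it isolates loner zero = w₃ and loner (suc zero) = w₇.
cut : Subset 7
cut = outside ∷ inside ∷ outside ∷ inside ∷ outside ∷ inside ∷ outside ∷ []

loner : Fin 2 → Fin 7
loner zero       = suc (suc zero)
loner (suc zero) = suc (suc (suc (suc (suc (suc zero)))))

lonerIndex : Fin 7 → Fin 2
lonerIndex r = if isYes (r ≟ loner zero) then zero else suc zero

loner∉cut : ∀ i → loner i ∉ cut
loner∉cut = from-yes (all? λ i → ¬? (loner i ∈? cut))

lonerIndex-loner : ∀ i → lonerIndex (loner i) ≡ i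
lonerIndex-loner zero       = refl
lonerIndex-loner (suc zero) = refl

-- Opaque so that goals mentioning root are never normalised; the facts in the following
-- unfolding block are checked by evaluation over all 2⁷ subsets of a copy.
opaque
  linked : Subset 7 → Fin 7 → Fin 7 → Bool
  linked = reachableWithin 6 copy

  -- Listing x and y first makes every component that meets {x, y} rooted at x or y.
  root : Subset 7 → Fin 7 → Fin 7
  root b a = fromMaybe a (findᵇ (linked b a) (x₀ ∷ y₀ ∷ allFinᴸ 7))

isolatedRoot : Subset 7 → Fin 7 → Bool
isolatedRoot b r = isYes (¬? (r ∈? b) ×-dec ¬? (T? (isXY r)) ×-dec root b r ≟ r)

opaque
  unfolding root

  root-linked : ∀ b a → a ∉ b → T (linked b a (root b a)) × T (linked b (root b a) a)
  root-linked = from-yes (allSubset? λ b → all? λ a →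
    ¬? (a ∈? b) →-dec T? (linked b a (root b a)) ×-dec T? (linked b (root b a) a))

  root-edge : ∀ b a c → a ∉ b → c ∉ b → copy a c ≡ true → root b a ≡ root b c
  root-edge = from-yes (allSubset? λ b → all? λ a → all? λ c →
    ¬? (a ∈? b) →-dec ¬? (c ∈? b) →-dec (copy a c ≟ᵇ true) →-dec (root b a ≟ root b c))

  root-xy : ∀ b a → a ∉ b → T (isXY a) → T (isXY (root b a))
  root-xy = from-yes (allSubset? λ b → all? λ a → ¬? (a ∈? b) →-dec T? (isXY a) →-dec T? (isXY (root b a)))

  isolatedRoots-bound : ∀ b → count (isolatedRoot b) ≤ 2 × 3 * count (isolatedRoot b) ≤ 2 * count (lookup b)
  isolatedRoots-bound = from-yes (allSubset? λ b →
    count (isolatedRoot b) ≤? 2 ×-dec 3 * count (isolatedRoot b) ≤? 2 * count (lookup b))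

  root-cut : ∀ a → a ∉ cut → T (isXY (root cut a)) ⊎ ∃ λ i → root cut a ≡ loner i
  root-cut = from-yes (all? λ a →
    ¬? (a ∈? cut) →-dec (T? (isXY (root cut a)) ⊎-dec any? λ i → root cut a ≟ loner i))

  root-loner : ∀ i → root cut (loner i) ≡ loner i
  root-loner zero       = refl
  root-loner (suc zero) = refl

opaque
  unfolding linked

  linked-sound : ∀ {b a c} → T (linked b a c) → Reach copy b a c
  linked-sound {b} {a} {c} = reachableWithin-sound 6 {copy} {b} {a} {c}

root∉ : ∀ {b a} → a ∉ b → root b a ∉ b
root∉ {b} {a} a∉ = Reach-target∉ (linked-sound {b} {a} {root b a} (proj₁ (root-linked b a a∉)))

root-idem : ∀ b a → a ∉ b → root b (root b a) ≡ root b a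
root-idem b a a∉ = sym (Reach-invariant {G = copy} {S = b} (root b) (λ {u} {v} → root-edge b u v)
                                        (linked-sound {b} {a} {root b a} (proj₁ (root-linked b a a∉))))

toℕ-≡ᵇ⇒≡ : ∀ {n} {i j : Fin n} → (toℕ i ≡ᵇ toℕ j) ≡ true → i ≡ j
toℕ-≡ᵇ⇒≡ {i = i} {j} eq = toℕ-injective (≡ᵇ⇒≡ (toℕ i) (toℕ j) (Equivalence.from T-≡ eq))

≡ᵇ-refl : ∀ n → (n ≡ᵇ n) ≡ true
≡ᵇ-refl n = Equivalence.to T-≡ (≡⇒≡ᵇ n n refl)

xy-edge : ∀ e {x y} z → T x → T y → z ≡ false → e ∨ (x ∧ y ∧ not z) ≡ true
xy-edge e {true} {true} false _ _ _ = ∨-zeroʳ e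

-- Twice the gap between the two sides is (2m − C)(2l − 3) + (1 + 2m)(2s − 3C).
toughness-gap : ∀ l′ m C d s e → C + d ≡ m * 2 → 3 * C + e ≡ 2 * s →
                2 * ((2 + l′ + 3 * m) * suc C) ≤ 2 * ((1 + 2 * m) * (2 + l′ + s))
toughness-gap l′ m C d s e C+d≡2m 3C+e≡2s = begin
  2 * ((2 + l′ + 3 * m) * suc C)
    ≡⟨ double-left l′ m C ⟩
  (2 * (2 + l′) + 3 * (m * 2)) * suc C
    ≡⟨ cong (λ x → (2 * (2 + l′) + 3 * x) * suc C) (sym C+d≡2m) ⟩
  (2 * (2 + l′) + 3 * (C + d)) * suc C
    ≤⟨ m≤m+n _ (d * (1 + 2 * l′)) ⟩
  (2 * (2 + l′) + 3 * (C + d)) * suc C + d * (1 + 2 * l′)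
    ≡⟨ slack l′ C d ⟩
  (1 + (C + d)) * (2 * (2 + l′) + 3 * C)
    ≤⟨ *-monoʳ-≤ (1 + (C + d)) (+-monoʳ-≤ (2 * (2 + l′)) (m≤m+n (3 * C) e)) ⟩
  (1 + (C + d)) * (2 * (2 + l′) + (3 * C + e))
    ≡⟨ cong₂ (λ x y → (1 + x) * (2 * (2 + l′) + y)) C+d≡2m 3C+e≡2s ⟩
  (1 + m * 2) * (2 * (2 + l′) + 2 * s)
    ≡⟨ double-right l′ m s ⟩
  2 * ((1 + 2 * m) * (2 + l′ + s))
    ∎
  where
  open ≤-Reasoning
  double-left : ∀ l′ m C → 2 * ((2 + l′ + 3 * m) * suc C) ≡ (2 * (2 + l′) + 3 * (m * 2)) * suc C
  double-left = solve-∀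
  slack : ∀ l′ C d → (2 * (2 + l′) + 3 * (C + d)) * suc C + d * (1 + 2 * l′)
                   ≡ (1 + (C + d)) * (2 * (2 + l′) + 3 * C)
  slack = solve-∀
  double-right : ∀ l′ m s → (1 + m * 2) * (2 * (2 + l′) + 2 * s) ≡ 2 * ((1 + 2 * m) * (2 + l′ + s))
  double-right = solve-∀

toughness-inequality : ∀ {l m k C s} → 2 ≤ l → k ≤ suc C → 3 * C ≤ 2 * s → C ≤ m * 2 →
                       (l + 3 * m) * k ≤ (1 + 2 * m) * (l + s)
toughness-inequality {m = m} {C = C} {s} 2≤l k≤1+C 3C≤2s C≤2m with m≤n⇒∃[o]m+o≡n 2≤l
... | l′ , refl = ≤-trans (*-monoʳ-≤ (2 + l′ + 3 * m) k≤1+C)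
                          (*-cancelˡ-≤ 2 (toughness-gap l′ m C _ s _ (m+[n∸m]≡n C≤2m) (m+[n∸m]≡n 3C≤2s)))

module Join (l m : ℕ) where

  G : Graph (l + m * 7)
  G = GL2 l m

  top : Fin l → Fin (l + m * 7)
  top t = t ↑ˡ m * 7

  vertex : Fin m → Fin 7 → Fin (l + m * 7)
  vertex j a = l ↑ʳ combine j a

  data View : Fin (l + m * 7) → Set where
    in-T : ∀ t → View (top t)
    in-F : ∀ j a → View (vertex j a)

  view : ∀ v → View v
  view v with splitAt l v in eq
  ... | inj₁ t = subst View (splitAt⁻¹-↑ˡ eq) (in-T t)
  ... | inj₂ p = subst View (trans (cong (l ↑ʳ_) (combine-remQuot {m} 7 p)) (splitAt⁻¹-↑ʳ eq))
                              (uncurry in-F (remQuot {m} 7 p))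

  G-vertex : ∀ j a j′ c → G (vertex j a) (vertex j′ c) ≡ Fadj (j , a) (j′ , c)
  G-vertex j a j′ c rewrite splitAt-↑ʳ l (m * 7) (combine j a) | splitAt-↑ʳ l (m * 7) (combine j′ c) =
    cong₂ Fadj (remQuot-combine j a) (remQuot-combine j′ c)

  G-copy : ∀ j a c → G (vertex j a) (vertex j c) ≡ copy a c
  G-copy j a c rewrite G-vertex j a j c | ≡ᵇ-refl (toℕ j) = refl

  G-xy : ∀ {j a j′ c} → T (isXY a) → T (isXY c) → vertex j a ≢ vertex j′ c → G (vertex j a) (vertex j′ c) ≡ true
  G-xy {j} {a} {j′} {c} xa xc ≢ with (toℕ j ≡ᵇ toℕ j′) ∧ (toℕ a ≡ᵇ toℕ c) in same
  ... | false = trans (G-vertex j a j′ c) (xy-edge _ _ xa xc same)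
  ... | true  = ⊥-elim (≢ (cong₂ vertex (toℕ-≡ᵇ⇒≡ (Equivalence.to T-≡ j≡ᵇj′)) (toℕ-≡ᵇ⇒≡ (Equivalence.to T-≡ a≡ᵇc))))
    where
    j≡ᵇj′×a≡ᵇc = Equivalence.to T-∧ (Equivalence.from T-≡ same)
    j≡ᵇj′ = proj₁ j≡ᵇj′×a≡ᵇc
    a≡ᵇc  = proj₂ j≡ᵇj′×a≡ᵇc

  G-top-vertex : ∀ t j a → G (top t) (vertex j a) ≡ true
  G-top-vertex t j a rewrite splitAt-↑ˡ l t (m * 7) | splitAt-↑ʳ l (m * 7) (combine j a) = refl

  G-top-top : ∀ {t t′} → t ≢ t′ → G (top t) (top t′) ≡ true
  G-top-top {t} {t′} t≢t′ rewrite splitAt-↑ˡ l t (m * 7) | splitAt-↑ˡ l t′ (m * 7) with toℕ t ≡ᵇ toℕ t′ in eq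
  ... | false = refl
  ... | true  = ⊥-elim (t≢t′ (toℕ-≡ᵇ⇒≡ eq))

  top-reaches : ∀ {S t v} → top t ∉ S → v ∉ S → Reach G S (top t) v
  top-reaches {t = t} {v} t∉ v∉ with view v
  ... | in-F j a = step (here t∉) (G-top-vertex t j a) v∉
  ... | in-T t′ with t ≟ t′
  ...   | yes refl = here t∉
  ...   | no t≢t′  = step (here t∉) (G-top-top t≢t′) v∉

  config : Subset (l + m * 7) → Fin m → Subset 7
  config S j = tabulate (λ a → lookup S (vertex j a))

  ∈-config⁺ : ∀ {S j a} → vertex j a ∈ S → a ∈ config S j
  ∈-config⁺ {S} {j} {a} v∈ =
    lookup⇒[]= a (config S j) (trans (lookup∘tabulate (λ a → lookup S (vertex j a)) a) ([]=⇒lookup v∈))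

  ∈-config⁻ : ∀ {S j a} → a ∈ config S j → vertex j a ∈ S
  ∈-config⁻ {S} {j} {a} a∈ =
    lookup⇒[]= (vertex j a) S (trans (sym (lookup∘tabulate (λ a → lookup S (vertex j a)) a)) ([]=⇒lookup a∈))

  Reach-lift : ∀ {S j a c} → Reach copy (config S j) a c → Reach G S (vertex j a) (vertex j c)
  Reach-lift {S} {j} = Reach-map (vertex j) (λ {a} {c} e → trans (G-copy j a c) e) (λ a∉ → a∉ ∘ ∈-config⁺)

  -- Slot zero is the component through the surviving x's and y's, slot (j , r) the component of
  -- copy j rooted at r. Vertices of T get the junk slot zero; slots are only used when T ⊆ S.
  Slot : Set
  Slot = Fin (suc (m * 7))

  rootSlot : Fin m → Fin 7 → Slot
  rootSlot j r = if isXY r then zero else suc (combine j r)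

  slot : Subset (l + m * 7) → Fin (l + m * 7) → Slot
  slot S v = [ (λ _ → zero) , (λ p → uncurry (λ j a → rootSlot j (root (config S j) a)) (remQuot 7 p)) ]′
               (splitAt l v)

  slot-vertex : ∀ S j a → slot S (vertex j a) ≡ rootSlot j (root (config S j) a)
  slot-vertex S j a rewrite splitAt-↑ʳ l (m * 7) (combine j a) =
    cong (uncurry (λ j a → rootSlot j (root (config S j) a))) (remQuot-combine j a)

  _⊇T : Subset (l + m * 7) → Set
  S ⊇T = ∀ t → top t ∈ S

  Reach-xy : ∀ {S j a j′ c} → T (isXY a) → T (isXY c) → vertex j a ∉ S → vertex j′ c ∉ S →
             Reach G S (vertex j a) (vertex j′ c)
  Reach-xy {j = j} {a} {j′} {c} xa xc a∉ c∉ with vertex j a ≟ vertex j′ c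
  ... | yes eq = subst (Reach G _ (vertex j a)) eq (here a∉)
  ... | no  ≢  = step (here a∉) (G-xy xa xc ≢) c∉

  root-Reach : ∀ {S j a} → vertex j a ∉ S →
               Reach G S (vertex j a) (vertex j (root (config S j) a)) ×
               Reach G S (vertex j (root (config S j) a)) (vertex j a)
  root-Reach a∉ with root-linked _ _ (a∉ ∘ ∈-config⁻)
  ... | a-r , r-a = Reach-lift (linked-sound a-r) , Reach-lift (linked-sound r-a)

  same-rootSlot⇒Reach : ∀ {S j a j′ c} → vertex j a ∉ S → vertex j′ c ∉ S →
                        rootSlot j (root (config S j) a) ≡ rootSlot j′ (root (config S j′) c) →
                        Reach G S (vertex j a) (vertex j′ c)
  same-rootSlot⇒Reach {S} {j} {a} {j′} {c} a∉ c∉ eq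
    with isXY (root (config S j) a) in xa | isXY (root (config S j′) c) in xc
  ... | true  | true  = Reach-trans a⇝r (Reach-trans r⇝r′ r′⇝c)
    where
    a⇝r  = proj₁ (root-Reach a∉)
    r′⇝c = proj₂ (root-Reach c∉)
    r⇝r′ = Reach-xy {S} {j} {root (config S j) a} {j′} {root (config S j′) c}
                    (Equivalence.from T-≡ xa) (Equivalence.from T-≡ xc) (Reach-target∉ a⇝r) (Reach-source∉ r′⇝c)
  ... | true  | false = contradiction eq λ ()
  ... | false | true  = contradiction eq λ ()
  ... | false | false with combine-injective j _ j′ _ (suc-injective eq)
  ...   | refl , r≡r′ = Reach-trans (proj₁ (root-Reach a∉))
                          (subst (λ r → Reach G S (vertex j r) (vertex j c)) (sym r≡r′) (proj₂ (root-Reach c∉)))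

  rootSlot-xy : ∀ {j r} → T (isXY r) → rootSlot j r ≡ zero
  rootSlot-xy {r = r} xr with isXY r | xr
  ... | true | _ = refl

  edge⇒same-rootSlot : ∀ {S j a j′ c} → vertex j a ∉ S → vertex j′ c ∉ S → Fadj (j , a) (j′ , c) ≡ true →
                       rootSlot j (root (config S j) a) ≡ rootSlot j′ (root (config S j′) c)
  edge⇒same-rootSlot {S} {j} {a} {j′} {c} a∉ c∉ e with toℕ j ≡ᵇ toℕ j′ in j≡ᵇj′
  ... | true with toℕ-≡ᵇ⇒≡ {i = j} {j′} j≡ᵇj′
  ...   | refl = cong (rootSlot j) (root-edge _ a c (a∉ ∘ ∈-config⁻) (c∉ ∘ ∈-config⁻) e)
  edge⇒same-rootSlot {S} {j} {a} {j′} {c} a∉ c∉ e | false =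
    trans (rootSlot-xy (root-xy _ a (a∉ ∘ ∈-config⁻) (proj₁ xa×xc)))
          (sym (rootSlot-xy (root-xy _ c (c∉ ∘ ∈-config⁻) (proj₁ (Equivalence.to T-∧ (proj₂ xa×xc))))))
    where
    xa×xc = Equivalence.to T-∧ (Equivalence.from T-≡ e)

  same-slot⇒Reach : ∀ {S} → S ⊇T → ∀ {u v} → u ∉ S → v ∉ S → slot S u ≡ slot S v → Reach G S u v
  same-slot⇒Reach {S} T⊆S {u} {v} u∉ v∉ eq with view u | view v
  ... | in-T t   | _        = ⊥-elim (u∉ (T⊆S t))
  ... | in-F _ _ | in-T t   = ⊥-elim (v∉ (T⊆S t))
  ... | in-F j a | in-F j′ c =
    same-rootSlot⇒Reach u∉ v∉ (trans (sym (slot-vertex S j a)) (trans eq (slot-vertex S j′ c)))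

  edge⇒same-slot : ∀ {S} → S ⊇T → ∀ {u v} → u ∉ S → v ∉ S → G u v ≡ true → slot S u ≡ slot S v
  edge⇒same-slot {S} T⊆S {u} {v} u∉ v∉ e with view u | view v
  ... | in-T t   | _        = ⊥-elim (u∉ (T⊆S t))
  ... | in-F _ _ | in-T t   = ⊥-elim (v∉ (T⊆S t))
  ... | in-F j a | in-F j′ c = trans (slot-vertex S j a) (trans
    (edge⇒same-rootSlot u∉ v∉ (trans (sym (G-vertex j a j′ c)) e)) (sym (slot-vertex S j′ c)))

  Reach⇒same-slot : ∀ {S} → S ⊇T → ∀ {u v} → Reach G S u v → slot S u ≡ slot S v
  Reach⇒same-slot {S} T⊆S = Reach-invariant (slot S) (edge⇒same-slot T⊆S)

  live : Subset (l + m * 7) → Slot → Bool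
  live S zero    = true
  live S (suc s) = uncurry (λ j r → isolatedRoot (config S j) r) (remQuot {m} 7 s)

  live-combine : ∀ S j r → live S (suc (combine j r)) ≡ isolatedRoot (config S j) r
  live-combine S j r = cong (uncurry (λ j r → isolatedRoot (config S j) r)) (remQuot-combine j r)

  slot-live : ∀ {S} → S ⊇T → ∀ {v} → v ∉ S → T (live S (slot S v))
  slot-live {S} T⊆S {v} v∉ with view v
  ... | in-T t = ⊥-elim (v∉ (T⊆S t))
  ... | in-F j a = subst (T ∘ live S) (sym (slot-vertex S j a)) (rootSlot-live (v∉ ∘ ∈-config⁻))
    where
    b = config S j
    rootSlot-live : a ∉ b → T (live S (rootSlot j (root b a)))
    rootSlot-live a∉ with isXY (root b a) in xr
    ... | true  = _
    ... | false = subst T (sym (live-combine S j (root b a)))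
      (fromWitness {a? = ¬? (root b a ∈? b) ×-dec ¬? (T? (isXY (root b a))) ×-dec root b (root b a) ≟ root b a}
                   (root∉ a∉ , subst T xr , root-idem b a a∉))

  count-live : ∀ S → count (live S) ≡ suc (sum (λ j → count (isolatedRoot (config S j))))
  count-live S = cong suc (count-combine m (λ j → isolatedRoot (config S j)) (live-combine S))

  ∣S∣-split : ∀ S → ∣ S ∣ ≡ count (lookup S ∘ top) + sum (λ j → count (lookup (config S j)))
  ∣S∣-split S = trans (∣p∣≡count S) (trans (count-++ l (lookup S))
    (cong (count (lookup S ∘ top) +_)
          (count-combine m (λ j → lookup (config S j)) (λ j a → sym (lookup∘tabulate (λ a → lookup S (vertex j a)) a)))))

  count-top : ∀ {S} → S ⊇T → count (lookup S ∘ top) ≡ l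
  count-top T⊆S = count-true (λ t → Equivalence.from T-≡ ([]=⇒lookup (T⊆S t)))

  lower-bound : 2 ≤ l → ∀ S k → HasComponents G S k → 2 ≤ k → (l + 3 * m) * k ≤ (1 + 2 * m) * ∣ S ∣
  lower-bound 2≤l S k components 2≤k with all? (λ t → top t ∈? S)
  ... | no T⊈S = contradiction (reaches-all⇒components≤1 components t∉ (top-reaches t∉)) (<⇒≱ 2≤k)
    where
    t∉ = proj₂ (¬∀⟶∃¬ l _ (λ t → top t ∈? S) T⊈S)
  ... | yes T⊆S = subst (λ n → (l + 3 * m) * k ≤ (1 + 2 * m) * n) (sym ∣S∣≡l+s)
                        (toughness-inequality {m = m} 2≤l k≤1+C 3C≤2s C≤2m)
    where
    C = sum (λ j → count (isolatedRoot (config S j)))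
    s = sum (λ j → count (lookup (config S j)))
    k≤1+C : k ≤ suc C
    k≤1+C = subst (k ≤_) (count-live S)
              (components≤count components (slot S) (live S) (same-slot⇒Reach T⊆S) (slot-live T⊆S))
    3C≤2s : 3 * C ≤ 2 * s
    3C≤2s = subst₂ _≤_ (sym (*-distribˡ-sum 3 (λ j → count (isolatedRoot (config S j)))))
                      (sym (*-distribˡ-sum 2 (λ j → count (lookup (config S j)))))
              (sum-mono-≤ (λ j → proj₂ (isolatedRoots-bound (config S j))))
    C≤2m : C ≤ m * 2
    C≤2m = subst (C ≤_) (sum-const {m} {2} (λ _ → refl))
             (sum-mono-≤ (λ j → proj₁ (isolatedRoots-bound (config S j))))
    ∣S∣≡l+s : ∣ S ∣ ≡ l + s
    ∣S∣≡l+s = trans (∣S∣-split S) (cong (_+ s) (count-top T⊆S))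

  inS₀ : Fin (l + m * 7) → Bool
  inS₀ v = [ (λ _ → true) , (λ p → lookup cut (proj₂ (remQuot {m} 7 p))) ]′ (splitAt l v)

  S₀ : Subset (l + m * 7)
  S₀ = tabulate inS₀

  S₀⊇T : S₀ ⊇T
  S₀⊇T t = lookup⇒[]= (top t) S₀
             (trans (lookup∘tabulate inS₀ (top t)) (cong [ _ , _ ]′ (splitAt-↑ˡ l t (m * 7))))

  config-S₀ : ∀ j → config S₀ j ≡ cut
  config-S₀ j =
    trans (tabulate-cong λ a → trans (lookup∘tabulate inS₀ (vertex j a)) (inS₀-vertex a)) (tabulate∘lookup cut)
    where
    inS₀-vertex : ∀ a → inS₀ (vertex j a) ≡ lookup cut a
    inS₀-vertex a rewrite splitAt-↑ʳ l (m * 7) (combine j a) = cong (lookup cut ∘ proj₂) (remQuot-combine j a)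

  ∣S₀∣ : ∣ S₀ ∣ ≡ l + m * 3
  ∣S₀∣ = trans (∣S∣-split S₀) (cong₂ _+_ (count-top S₀⊇T) (sum-const (λ j → cong (count ∘ lookup) (config-S₀ j))))

  pack : Slot → Fin (suc (m * 2))
  pack zero    = zero
  pack (suc s) = uncurry (λ j r → suc (combine j (lonerIndex r))) (remQuot {m} 7 s)

  unpack : Fin (suc (m * 2)) → Slot
  unpack zero    = zero
  unpack (suc s) = uncurry (λ j i → suc (combine j (loner i))) (remQuot {m} 2 s)

  rootSlot-loner : ∀ (j : Fin m) i → rootSlot j (loner i) ≡ suc (combine j (loner i))
  rootSlot-loner j zero       = refl
  rootSlot-loner j (suc zero) = refl

  pack-loner : ∀ (j : Fin m) i → pack (suc (combine j (loner i))) ≡ suc (combine j i)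
  pack-loner j i =
    trans (cong (uncurry (λ (j : Fin m) r → suc (combine j (lonerIndex r)))) (remQuot-combine j (loner i)))
          (cong (suc ∘ combine j) (lonerIndex-loner i))

  unpack-combine : ∀ (j : Fin m) i → unpack (suc (combine j i)) ≡ suc (combine j (loner i))
  unpack-combine j i = cong (uncurry (λ (j : Fin m) i → suc (combine j (loner i)))) (remQuot-combine j i)

  unpack-pack : ∀ (j : Fin m) r → T (isXY r) ⊎ ∃ (λ i → r ≡ loner i) → unpack (pack (rootSlot j r)) ≡ rootSlot j r
  unpack-pack j r (inj₁ xr) = trans (cong (unpack ∘ pack) (rootSlot-xy xr)) (sym (rootSlot-xy xr))
  unpack-pack j r (inj₂ (i , refl)) = begin
    unpack (pack (rootSlot j (loner i)))          ≡⟨ cong (unpack ∘ pack) (rootSlot-loner j i) ⟩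
    unpack (pack (suc (combine j (loner i))))     ≡⟨ cong unpack (pack-loner j i) ⟩
    unpack (suc (combine j i))                    ≡⟨ unpack-combine j i ⟩
    suc (combine j (loner i))                     ≡⟨ rootSlot-loner j i ⟨
    rootSlot j (loner i)                          ∎
    where open ≡-Reasoning

  vertex∉S₀ : ∀ {j a} → a ∉ cut → vertex j a ∉ S₀
  vertex∉S₀ {j} {a} a∉ v∈ = a∉ (subst (a ∈_) (config-S₀ j) (∈-config⁺ v∈))

  components-S₀ : 1 ≤ m → HasComponents G S₀ (suc (m * 2))
  components-S₀ 1≤m =
    (λ v _ → pack (slot S₀ v)) ,
    (λ u v u∉ v∉ → mk⇔ (pack≡⇒Reach u∉ v∉) (cong pack ∘ Reach⇒same-slot S₀⊇T)) ,
    onto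
    where
    unpack-pack-slot : ∀ {v} → v ∉ S₀ → unpack (pack (slot S₀ v)) ≡ slot S₀ v
    unpack-pack-slot {v} v∉ with view v
    ... | in-T t = ⊥-elim (v∉ (S₀⊇T t))
    ... | in-F j a rewrite slot-vertex S₀ j a | config-S₀ j =
      unpack-pack j (root cut a) (root-cut a (λ a∈ → v∉ (∈-config⁻ (subst (a ∈_) (sym (config-S₀ j)) a∈))))

    pack≡⇒Reach : ∀ {u v} → u ∉ S₀ → v ∉ S₀ → pack (slot S₀ u) ≡ pack (slot S₀ v) → Reach G S₀ u v
    pack≡⇒Reach u∉ v∉ eq = same-slot⇒Reach S₀⊇T u∉ v∉
      (trans (sym (unpack-pack-slot u∉)) (trans (cong unpack eq) (unpack-pack-slot v∉)))

    onto : ∀ i → ∃ λ v → Σ (v ∉ S₀) λ v∉ → pack (slot S₀ v) ≡ i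
    onto zero = vertex j₀ x₀ , vertex∉S₀ x₀∉ , cong pack (trans (slot-vertex S₀ j₀ x₀)
                  (rootSlot-xy (root-xy _ x₀ (subst (x₀ ∉_) (sym (config-S₀ j₀)) x₀∉) _)))
      where
      j₀ = fromℕ< 1≤m
      x₀∉ : x₀ ∉ cut
      x₀∉ ()
    onto (suc s) = vertex j (loner i) , vertex∉S₀ (loner∉cut i) , (begin
      pack (slot S₀ (vertex j (loner i)))                 ≡⟨ cong pack (slot-vertex S₀ j (loner i)) ⟩
      pack (rootSlot j (root (config S₀ j) (loner i)))    ≡⟨ cong (λ b → pack (rootSlot j (root b (loner i)))) (config-S₀ j) ⟩
      pack (rootSlot j (root cut (loner i)))              ≡⟨ cong (pack ∘ rootSlot j) (root-loner i) ⟩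
      pack (rootSlot j (loner i))                         ≡⟨ cong pack (rootSlot-loner j i) ⟩
      pack (suc (combine j (loner i)))                    ≡⟨ pack-loner j i ⟩
      suc (combine j i)                                   ≡⟨ cong suc (combine-remQuot {m} 2 s) ⟩
      suc s                                               ∎)
      where
      open ≡-Reasoning
      j = proj₁ (remQuot {m} 2 s)
      i = proj₂ (remQuot {m} 2 s)

claim3 : (l m : ℕ) → 2 ≤ l → 1 ≤ m → IsToughness (GL2 l m) (l + 3 * m) (1 + 2 * m)
claim3 l m 2≤l 1≤m =
  s≤s z≤n ,
  lower-bound 2≤l ,
  (S₀ , suc (m * 2) , components-S₀ 1≤m , s≤s (≤-trans (s≤s z≤n) (*-monoˡ-≤ 2 1≤m)) , attained)
  where
  open Join l m
  balanced : ∀ l m → (l + 3 * m) * suc (m * 2) ≡ (1 + 2 * m) * (l + m * 3)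
  balanced = solve-∀
  attained : (l + 3 * m) * suc (m * 2) ≡ (1 + 2 * m) * ∣ S₀ ∣
  attained = trans (balanced l m) (cong ((1 + 2 * m) *_) (sym ∣S₀∣))
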